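{- Let $(\mathbf{A},\tau)$ be a $2$-subtractive $T_0$-topological algebra with subtraction term $s_1$ and constant $0$, and let $a,b\in A$. If $s_1(a,b)\neq 0$, then $a$ and $b$ are $T_{2\frac12}$-separated. In particular, for every $a\in A\setminus\{0\}$, $a$ and $0$ are $T_{2\frac12}$-separated.
   Context: An algebra is $2$-subtractive if there are a constant $0$ and a binary term $s_1$ with $s_1(x,x)=0$ and $s_1(x,0)=x$. A topological algebra is an algebra with a topology making all basic operations continuous; $T_0$ refers to the topology. Points $c,d$ are $T_{2\frac12}$-separated if there are open sets $U\ni c$, $V\ni d$ with $\overline U\cap\overline V=\emptyset$. -}

module Defs where

open import Data.Nat using (ℕ)
open import Data.Fin using (Fin; zero; suc)
open import Data.Product using (Σ; ∃; _×_; _,_)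
open import Data.Sum using (_⊎_)
open import Data.Empty using (⊥)
open import Data.Unit using (⊤)
open import Relation.Nullary using (¬_)
open import Relation.Binary.PropositionalEquality using (_≡_)

Subset : Set → Set₁
Subset A = A → Set

record Topology (A : Set) : Set₁ where
  field
    Open       : Subset A → Set
    open-full  : Open (λ _ → ⊤)
    open-∩     : ∀ {U V} → Open U → Open V → Open (λ x → U x × V x)
    open-⋃     : ∀ {I : Set} (U : I → Subset A) → (∀ i → Open (U i))
                 → Open (λ x → ∃ λ i → U i x)
  closure : Subset A → A → Set₁
  closure U x = ∀ V → Open V → V x → ∃ λ y → V y × U y

T0 : {A : Set} → Topology A → Set₁
T0 {A} τ = ∀ (x y : A) → ¬ x ≡ y →
  Σ (Subset A) λ U → Topology.Open τ U × ((U x × ¬ U y) ⊎ (U y × ¬ U x))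

T2½-separated : {A : Set} → Topology A → A → A → Set₁
T2½-separated {A} τ c d = Σ (Subset A) λ U → Σ (Subset A) λ V →
  Open U × Open V × U c × V d ×
  (∀ x → closure U x → closure V x → ⊥)
  where open Topology τ

record Signature : Set₁ where
  field
    Op    : Set
    arity : Op → ℕ

record Algebra (Σ' : Signature) : Set₁ where
  open Signature Σ'
  field
    Carrier : Set
    ⟦_⟧     : (f : Op) → (Fin (arity f) → Carrier) → Carrier

data Term (Σ' : Signature) (n : ℕ) : Set where
  var : Fin n → Term Σ' n
  op  : (f : Signature.Op Σ') → (Fin (Signature.arity Σ' f) → Term Σ' n) → Term Σ' n

eval : {Σ' : Signature} (𝐀 : Algebra Σ') {n : ℕ} → Term Σ' n
       → (Fin n → Algebra.Carrier 𝐀) → Algebra.Carrier 𝐀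
eval 𝐀 (var i)   ρ = ρ i
eval 𝐀 (op f ts) ρ = Algebra.⟦_⟧ 𝐀 f (λ i → eval 𝐀 (ts i) ρ)

-- Continuity of a map A^n → A, A^n carrying the product topology
-- (unfolded: around every point of a preimage of an open set there is a
-- basic open box contained in that preimage).
Continuous : {A : Set} (τ : Topology A) {n : ℕ} → ((Fin n → A) → A) → Set₁
Continuous {A} τ {n} g = ∀ (U : Subset A) → Open U → ∀ (ρ : Fin n → A) → U (g ρ) →
  Σ (Fin n → Subset A) λ V → (∀ i → Open (V i)) × (∀ i → V i (ρ i)) ×
    (∀ σ → (∀ i → V i (σ i)) → U (g σ))
  where open Topology τ

IsTopologicalAlgebra : {Σ' : Signature} (𝐀 : Algebra Σ') → Topology (Algebra.Carrier 𝐀) → Set₁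
IsTopologicalAlgebra {Σ'} 𝐀 τ = ∀ (f : Signature.Op Σ') → Continuous τ (Algebra.⟦_⟧ 𝐀 f)

[_,_] : {A : Set} → A → A → Fin 2 → A
[ x , y ] zero = x
[ x , y ] (suc zero) = y

no-vars : {A : Set} → Fin 0 → A
no-vars ()

Is2Subtractive : {Σ' : Signature} (𝐀 : Algebra Σ') → Term Σ' 2 → Term Σ' 0 → Set
Is2Subtractive 𝐀 s₁ z =
  (∀ x → eval 𝐀 s₁ [ x , x ] ≡ eval 𝐀 z no-vars) ×
  (∀ x → eval 𝐀 s₁ [ x , eval 𝐀 z no-vars ] ≡ x)

module Submission where

-- Proof idea.  Write 0 for the constant and x ∸ y for s₁(x , y); c = a ∸ b.
--
-- (1) Term operations of a topological algebra are continuous: this follows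
--     by induction on terms from the continuity of the basic operations,
--     using that finite intersections of open sets are open.  In particular
--     _∸_ is jointly continuous.
-- (2) Key lemma: if an open set W contains c but not 0, then a and b are
--     T_{2½}-separated.  From c ∸ 0 = c ∈ W pick open P ∋ c, N ∋ 0 with
--     P ∸ N ⊆ W, and from a ∸ b ∈ P pick open U ∋ a, V ∋ b with U ∸ V ⊆ P.
--     If x lies in both closures, x ∸ x = 0 ∈ N gives neighbourhoods
--     B₁, B₂ of x with B₁ ∸ B₂ ⊆ N; choosing u ∈ B₁ ∩ U, v ∈ B₂ ∩ V, the
--     point w = u ∸ v lies in P ∩ N, so 0 = w ∸ w ∈ W, a contradiction.
-- (3) T0 gives an open set separating c ≠ 0 in one direction.  If it
--     contains 0 but not c, the (open) preimage of it under c ∸ _ contains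
--     c (as c ∸ c = 0) but not 0 (as c ∸ 0 = c), so (2) always applies.
-- The second claim is the first one for b = 0, since a ∸ 0 = a.

open import Defs
open import Data.Nat using (ℕ; zero; suc)
open import Data.Fin using (Fin; zero; suc)
import Data.Fin as Fin
open import Data.Product using (Σ; ∃; _×_; _,_; proj₁; proj₂)
open import Data.Sum using (inj₁; inj₂)
open import Data.Empty using (⊥; ⊥-elim)
open import Data.Unit using (⊤; tt)
open import Relation.Nullary using (¬_; Dec; yes; no)
open import Relation.Binary.PropositionalEquality using (_≡_; refl; sym; subst)

module TopologyFacts {A : Set} (τ : Topology A) where
  open Topology τ

  ⋂ : {m : ℕ} → (Fin m → Subset A) → Subset A
  ⋂ {zero}  G = λ _ → ⊤
  ⋂ {suc m} G = λ x → G zero x × ⋂ (λ k → G (suc k)) x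

  ⋂-open : {m : ℕ} (G : Fin m → Subset A) → (∀ k → Open (G k)) → Open (⋂ G)
  ⋂-open {zero}  G _      = open-full
  ⋂-open {suc m} G G-open =
    open-∩ (G-open zero) (⋂-open (λ k → G (suc k)) (λ k → G-open (suc k)))

  ⋂-intro : {m : ℕ} (G : Fin m → Subset A) {x : A} → (∀ k → G k x) → ⋂ G x
  ⋂-intro {zero}  G _   = tt
  ⋂-intro {suc m} G x∈G = x∈G zero , ⋂-intro (λ k → G (suc k)) (λ k → x∈G (suc k))

  ⋂-elim : {m : ℕ} (G : Fin m → Subset A) {x : A} → ⋂ G x → ∀ k → G k x
  ⋂-elim {suc m} G (x∈G₀ , _)    zero    = x∈G₀
  ⋂-elim {suc m} G (_    , x∈Gₛ) (suc k) = ⋂-elim (λ k → G (suc k)) x∈Gₛ k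

  -- The set U when the proposition P holds, the whole space otherwise; used
  -- to build the open box which constrains only one coordinate.
  whenever : {P : Set} → Dec P → Subset A → Subset A
  whenever (yes _) U = U
  whenever (no _)  _ = λ _ → ⊤

  whenever-open : {P : Set} (P? : Dec P) {U : Subset A} → Open U → Open (whenever P? U)
  whenever-open (yes _) U-open = U-open
  whenever-open (no _)  _      = open-full

  whenever-intro : {P : Set} (P? : Dec P) {U : Subset A} {x : A} → (P → U x) → whenever P? U x
  whenever-intro (yes p) x∈U = x∈U p
  whenever-intro (no _)  _   = tt

  whenever-elim : {P : Set} (P? : Dec P) {U : Subset A} {x : A} → P → whenever P? U x → U x
  whenever-elim (yes _) _ x∈U = x∈U
  whenever-elim (no ¬p) p _   = ⊥-elim (¬p p)

  projection-continuous : {n : ℕ} (i : Fin n) → Continuous τ (λ ρ → ρ i)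
  projection-continuous i U U-open ρ ρi∈U =
    (λ j → whenever (j Fin.≟ i) U) ,
    (λ j → whenever-open (j Fin.≟ i) U-open) ,
    (λ j → whenever-intro (j Fin.≟ i) λ { refl → ρi∈U }) ,
    (λ σ σ∈box → whenever-elim (i Fin.≟ i) refl (σ∈box i))

  -- A set S in which every point has an open neighbourhood inside S is
  -- pointwise equivalent to an open set, namely the union of these
  -- neighbourhoods (openness is not closed under pointwise equivalence).
  locally-open : (S : Subset A)
    → (∀ x → S x → Σ (Subset A) λ U → Open U × U x × (∀ y → U y → S y))
    → Σ (Subset A) λ O → Open O × (∀ x → S x → O x) × (∀ x → O x → S x)
  locally-open S nbhd = O , open-⋃ around (λ { (x , x∈S) → open-around x x∈S }) ,
    (λ x x∈S → (x , x∈S) , centre x x∈S) ,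
    (λ { y ((x , x∈S) , y∈U) → inside x x∈S y y∈U })
    where
    around : Σ A S → Subset A
    around (x , x∈S) with nbhd x x∈S
    ... | U , _ = U
    open-around : ∀ x (x∈S : S x) → Open (around (x , x∈S))
    open-around x x∈S with nbhd x x∈S
    ... | _ , U-open , _ = U-open
    centre : ∀ x (x∈S : S x) → around (x , x∈S) x
    centre x x∈S with nbhd x x∈S
    ... | _ , _ , x∈U , _ = x∈U
    inside : ∀ x (x∈S : S x) y → around (x , x∈S) y → S y
    inside x x∈S with nbhd x x∈S
    ... | _ , _ , _ , U⊆S = U⊆S
    O : Subset A
    O y = ∃ λ p → around p y

  record Nbhd₂ (g : A → A → A) (W : Subset A) (x y : A) : Set₁ where
    field
      P Q    : Subset A
      P-open : Open P
      Q-open : Open Q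
      x∈P    : P x
      y∈Q    : Q y
      g[P,Q]⊆W : ∀ u v → P u → Q v → W (g u v)

  continuous₂ : (g : (Fin 2 → A) → A) → Continuous τ g
    → ∀ W → Open W → ∀ x y → W (g [ x , y ]) → Nbhd₂ (λ u v → g [ u , v ]) W x y
  continuous₂ g g-cont W W-open x y g[x,y]∈W with g-cont W W-open [ x , y ] g[x,y]∈W
  ... | V , V-open , V∋ , V⊆ = record
    { P = V zero ; Q = V (suc zero)
    ; P-open = V-open zero ; Q-open = V-open (suc zero)
    ; x∈P = V∋ zero ; y∈Q = V∋ (suc zero)
    ; g[P,Q]⊆W = λ u v u∈P v∈Q → V⊆ [ u , v ] λ { zero → u∈P ; (suc zero) → v∈Q }
    }

term-continuous : {Σ' : Signature} (𝐀 : Algebra Σ') (τ : Topology (Algebra.Carrier 𝐀))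
  → IsTopologicalAlgebra 𝐀 τ → {n : ℕ} (t : Term Σ' n) → Continuous τ (eval 𝐀 t)
term-continuous 𝐀 τ ops-cont (var i) = TopologyFacts.projection-continuous τ i
term-continuous {Σ'} 𝐀 τ ops-cont {n} (op f ts) U U-open ρ fρ∈U
  with ops-cont f U U-open (λ k → eval 𝐀 (ts k) ρ) fρ∈U
... | W , W-open , W∋ , W⊆ = V , V-open , V∋ , V⊆
  where
  open Topology τ
  open TopologyFacts τ
  A = Algebra.Carrier 𝐀
  box : Fin (Signature.arity Σ' f) → Fin n → Subset A
  box k with term-continuous 𝐀 τ ops-cont (ts k) (W k) (W-open k) ρ (W∋ k)
  ... | B , _ = B
  box-open : ∀ k j → Open (box k j)
  box-open k with term-continuous 𝐀 τ ops-cont (ts k) (W k) (W-open k) ρ (W∋ k)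
  ... | _ , B-open , _ = B-open
  box∋ : ∀ k j → box k j (ρ j)
  box∋ k with term-continuous 𝐀 τ ops-cont (ts k) (W k) (W-open k) ρ (W∋ k)
  ... | _ , _ , B∋ , _ = B∋
  box⊆ : ∀ k σ → (∀ j → box k j (σ j)) → W k (eval 𝐀 (ts k) σ)
  box⊆ k with term-continuous 𝐀 τ ops-cont (ts k) (W k) (W-open k) ρ (W∋ k)
  ... | _ , _ , _ , B⊆ = B⊆
  V : Fin n → Subset A
  V j = ⋂ (λ k → box k j)
  V-open : ∀ j → Open (V j)
  V-open j = ⋂-open _ (λ k → box-open k j)
  V∋ : ∀ j → V j (ρ j)
  V∋ j = ⋂-intro _ (λ k → box∋ k j)
  V⊆ : ∀ σ → (∀ j → V j (σ j)) → U (eval 𝐀 (op f ts) σ)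
  V⊆ σ σ∈V = W⊆ _ (λ k → box⊆ k σ (λ j → ⋂-elim _ (σ∈V j) k))

module Subtractive {Σ' : Signature} (𝐀 : Algebra Σ') (τ : Topology (Algebra.Carrier 𝐀))
  (ops-cont : IsTopologicalAlgebra 𝐀 τ) (s₁ : Term Σ' 2) (z : Term Σ' 0)
  (subtractive : Is2Subtractive 𝐀 s₁ z) where

  open Topology τ
  open TopologyFacts τ
  A = Algebra.Carrier 𝐀

  𝟎 : A
  𝟎 = eval 𝐀 z no-vars

  _∸_ : A → A → A
  x ∸ y = eval 𝐀 s₁ [ x , y ]

  x∸x≡𝟎 : ∀ x → x ∸ x ≡ 𝟎
  x∸x≡𝟎 = proj₁ subtractive

  x∸𝟎≡x : ∀ x → x ∸ 𝟎 ≡ x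
  x∸𝟎≡x = proj₂ subtractive

  ∸-continuous : ∀ W → Open W → ∀ x y → W (x ∸ y) → Nbhd₂ _∸_ W x y
  ∸-continuous = continuous₂ (eval 𝐀 s₁) (term-continuous 𝐀 τ ops-cont s₁)

  separate-via : ∀ W → Open W → ∀ a b → W (a ∸ b) → ¬ W 𝟎 → T2½-separated τ a b
  separate-via W W-open a b a∸b∈W 𝟎∉W =
    P′.P , P′.Q , P′.P-open , P′.Q-open , P′.x∈P , P′.y∈Q , disjoint-closures
    where
    W′ = ∸-continuous W W-open (a ∸ b) 𝟎 (subst W (sym (x∸𝟎≡x (a ∸ b))) a∸b∈W)
    module W′ = Nbhd₂ W′
    P′ = ∸-continuous W′.P W′.P-open a b W′.x∈P
    module P′ = Nbhd₂ P′
    disjoint-closures : ∀ x → closure P′.P x → closure P′.Q x → ⊥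
    disjoint-closures x x∈clU x∈clV
      with ∸-continuous W′.Q W′.Q-open x x (subst W′.Q (sym (x∸x≡𝟎 x)) W′.y∈Q)
    ... | record { P = B₁ ; Q = B₂ ; P-open = B₁-open ; Q-open = B₂-open
                 ; x∈P = x∈B₁ ; y∈Q = x∈B₂ ; g[P,Q]⊆W = B₁∸B₂⊆N }
      with x∈clU B₁ B₁-open x∈B₁ | x∈clV B₂ B₂-open x∈B₂
    ... | u , u∈B₁ , u∈U | v , v∈B₂ , v∈V = 𝟎∉W (subst W (x∸x≡𝟎 w) w∸w∈W)
      where
      w = u ∸ v
      w∸w∈W : W (w ∸ w)
      w∸w∈W = W′.g[P,Q]⊆W w w (P′.g[P,Q]⊆W u v u∈U v∈V) (B₁∸B₂⊆N u v u∈B₁ v∈B₂)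

  left-translate-open : ∀ c W → Open W
    → Σ (Subset A) λ O → Open O × (∀ y → W (c ∸ y) → O y) × (∀ y → O y → W (c ∸ y))
  left-translate-open c W W-open = locally-open (λ y → W (c ∸ y)) nbhd
    where
    nbhd : ∀ y → W (c ∸ y) → Σ (Subset A) λ U → Open U × U y × (∀ v → U v → W (c ∸ v))
    nbhd y c∸y∈W = Q , Q-open , y∈Q , (λ v v∈Q → g[P,Q]⊆W c v x∈P v∈Q)
      where open Nbhd₂ (∸-continuous W W-open c y c∸y∈W)

  open-avoiding-𝟎 : T0 τ → ∀ c → ¬ c ≡ 𝟎 → Σ (Subset A) λ W → Open W × W c × ¬ W 𝟎
  open-avoiding-𝟎 t0 c c≢𝟎 with t0 c 𝟎 c≢𝟎
  ... | W , W-open , inj₁ (c∈W , 𝟎∉W) = W , W-open , c∈W , 𝟎∉W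
  ... | W , W-open , inj₂ (𝟎∈W , c∉W) with left-translate-open c W W-open
  ... | O , O-open , O⊇ , O⊆ =
    O , O-open ,
    O⊇ c (subst W (sym (x∸x≡𝟎 c)) 𝟎∈W) ,
    (λ 𝟎∈O → c∉W (subst W (x∸𝟎≡x c) (O⊆ 𝟎 𝟎∈O)))

  separated : T0 τ → ∀ a b → ¬ a ∸ b ≡ 𝟎 → T2½-separated τ a b
  separated t0 a b a∸b≢𝟎 with open-avoiding-𝟎 t0 (a ∸ b) a∸b≢𝟎
  ... | W , W-open , a∸b∈W , 𝟎∉W = separate-via W W-open a b a∸b∈W 𝟎∉W

corollary6p10 : (Σ' : Signature) (𝐀 : Algebra Σ') (τ : Topology (Algebra.Carrier 𝐀))
    → IsTopologicalAlgebra 𝐀 τ → T0 τ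
    → (s₁ : Term Σ' 2) (z : Term Σ' 0) → Is2Subtractive 𝐀 s₁ z
    → ((a b : Algebra.Carrier 𝐀) → ¬ eval 𝐀 s₁ [ a , b ] ≡ eval 𝐀 z no-vars → T2½-separated τ a b)
    × ((a : Algebra.Carrier 𝐀) → ¬ a ≡ eval 𝐀 z no-vars → T2½-separated τ a (eval 𝐀 z no-vars))
corollary6p10 Σ' 𝐀 τ ops-cont t0 s₁ z subtractive =
  separated t0 ,
  λ a a≢𝟎 → separated t0 a 𝟎 (λ a∸𝟎≡𝟎 → a≢𝟎 (subst (_≡ 𝟎) (x∸𝟎≡x a) a∸𝟎≡𝟎))
  where open Subtractive 𝐀 τ ops-cont s₁ z subtractive
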